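{- Let $I$ be a fuzzy implication satisfying (A5) with a binary aggregation function $A$. If $N_I>N_\bot$ (i.e. $N_I(x)\ge N_\bot(x)$ for all $x$ and $N_I\ne N_\bot$), then $A$ has zero divisors, i.e. there exist $x,y\in(0,1]$ with $A(x,y)=0$.
   Context: A binary aggregation function is a map $A:[0,1]^2\to[0,1]$, non-decreasing in each variable, with $A(0,0)=0$, $A(1,1)=1$. A fuzzy implication is a map $I:[0,1]^2\to[0,1]$, non-increasing in the first variable, non-decreasing in the second, with $I(0,0)=I(1,1)=1$, $I(1,0)=0$. Its natural negation is $N_I(x)=I(x,0)$. $N_\bot$ denotes the fuzzy negation with $N_\bot(0)=1$ and $N_\bot(x)=0$ for $x\in(0,1]$. A fuzzy set on a nonempty set $U$ is a map $D:U\to[0,1]$; it is normal if $D(x_0)=1$ for some $x_0\in U$. $I$ satisfies (A5) with $A$ if for all nonempty sets $U,V$, all normal fuzzy sets $D$ on $U$ and $B$ on $V$, and all $y\in V$: $B(y)=\sup_{x\in U}A\big(D(x),I(D(x),B(y))\big)$. -}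

module Defs where

open import Level using (0ℓ)
open import Data.Product using (Σ; ∃; ∃₂; _×_; _,_)
open import Relation.Nullary using (¬_; yes; no)
open import Relation.Binary.PropositionalEquality using (_≡_)
open import Relation.Binary.Definitions using (DecidableEquality)
open import Relation.Binary.Structures using (IsTotalOrder)
open import Algebra.Structures using (IsCommutativeRing)

-- The real numbers, axiomatised as a (Dedekind-)complete ordered field.
-- Every such structure is isomorphic to ℝ (classically), so quantifying over
-- all of them is the same as speaking about ℝ.
record CompleteOrderedField : Set₁ where
  infixl 6 _+_
  infixl 7 _*_
  infix 4 _≤_
  field
    ℝ        : Set
    _+_ _*_  : ℝ → ℝ → ℝ
    -_       : ℝ → ℝ
    0ℝ 1ℝ    : ℝ
    _≤_      : ℝ → ℝ → Set
    isCommutativeRing : IsCommutativeRing _≡_ _+_ _*_ -_ 0ℝ 1ℝ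
    0≢1      : ¬ (0ℝ ≡ 1ℝ)
    inverse  : (x : ℝ) → ¬ (x ≡ 0ℝ) → Σ ℝ (λ y → x * y ≡ 1ℝ)
    isTotalOrder : IsTotalOrder _≡_ _≤_
    +-mono-≤ : ∀ {x y} z → x ≤ y → x + z ≤ y + z
    *-nonneg : ∀ {x y} → 0ℝ ≤ x → 0ℝ ≤ y → 0ℝ ≤ x * y
    _≟_      : DecidableEquality ℝ
    complete : (S : ℝ → Set) → Σ ℝ S → Σ ℝ (λ b → ∀ x → S x → x ≤ b) →
               Σ ℝ (λ s → (∀ x → S x → x ≤ s) ×
                          (∀ b → (∀ x → S x → x ≤ b) → s ≤ b))

module Fuzzy (R : CompleteOrderedField) where
  open CompleteOrderedField R

  _<_ : ℝ → ℝ → Set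
  x < y = x ≤ y × ¬ (x ≡ y)

  InI : ℝ → Set
  InI x = 0ℝ ≤ x × x ≤ 1ℝ

  -- binary aggregation function on [0,1] (values outside [0,1]² are irrelevant)
  IsAggregation : (ℝ → ℝ → ℝ) → Set
  IsAggregation A =
    (∀ x y → InI x → InI y → InI (A x y)) ×
    (∀ x₁ x₂ y → InI x₁ → InI x₂ → InI y → x₁ ≤ x₂ → A x₁ y ≤ A x₂ y) ×
    (∀ x y₁ y₂ → InI x → InI y₁ → InI y₂ → y₁ ≤ y₂ → A x y₁ ≤ A x y₂) ×
    (A 0ℝ 0ℝ ≡ 0ℝ) × (A 1ℝ 1ℝ ≡ 1ℝ)

  IsFuzzyImplication : (ℝ → ℝ → ℝ) → Set
  IsFuzzyImplication I =
    (∀ x y → InI x → InI y → InI (I x y)) ×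
    (∀ x₁ x₂ y → InI x₁ → InI x₂ → InI y → x₁ ≤ x₂ → I x₂ y ≤ I x₁ y) ×
    (∀ x y₁ y₂ → InI x → InI y₁ → InI y₂ → y₁ ≤ y₂ → I x y₁ ≤ I x y₂) ×
    (I 0ℝ 0ℝ ≡ 1ℝ) × (I 1ℝ 1ℝ ≡ 1ℝ) × (I 1ℝ 0ℝ ≡ 0ℝ)

  NI : (ℝ → ℝ → ℝ) → ℝ → ℝ
  NI I x = I x 0ℝ

  N⊥ : ℝ → ℝ
  N⊥ x with x ≟ 0ℝ
  ... | yes _ = 1ℝ
  ... | no  _ = 0ℝ

  IsFuzzySet : {U : Set} → (U → ℝ) → Set
  IsFuzzySet D = ∀ u → InI (D u)

  IsNormal : {U : Set} → (U → ℝ) → Set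
  IsNormal {U} D = Σ U (λ u → D u ≡ 1ℝ)

  IsSup : (ℝ → Set) → ℝ → Set
  IsSup S s = (∀ z → S z → z ≤ s) × (∀ b → (∀ z → S z → z ≤ b) → s ≤ b)

  -- (A5): B(y) = sup_{x ∈ U} A(D x, I(D x, B y))
  -- (U, V nonempty is implied by normality of D and B.)
  SatisfiesA5 : (I A : ℝ → ℝ → ℝ) → Set₁
  SatisfiesA5 I A =
    (U V : Set) (D : U → ℝ) (B : V → ℝ) →
    IsFuzzySet D → IsNormal D → IsFuzzySet B → IsNormal B → (y : V) →
    IsSup (λ z → Σ U (λ x → z ≡ A (D x) (I (D x) (B y)))) (B y)

module Submission where

open import Defs
open import Level using (0ℓ)
open import Axiom.ExcludedMiddle using (ExcludedMiddle)
open import Axiom.DoubleNegationElimination using (em⇒dne)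
open import Data.Bool using (Bool; true; false)
open import Data.Empty using (⊥-elim)
open import Data.Product using (Σ; ∃; _×_; _,_; proj₁; proj₂)
open import Function using (_∘_)
open import Relation.Nullary using (¬_; yes; no)
open import Relation.Binary.PropositionalEquality using (_≡_; refl; sym; trans)
open import Relation.Binary.Structures using (IsTotalOrder)

-- Taking D = (1, x) and B = (1, y) on a two-point set, (A5) at the point where B is y makes
-- A(x, I(x, y)) one of the terms whose supremum is y; with y = 0 this term is forced to vanish.
-- A point x where N_I and N⊥ differ is nonzero (both are 1 at 0) and has I(x, 0) ≠ 0, so
-- (x, I(x, 0)) is a pair of zero divisors.

¬∀⇒∃×¬ : ∀ {ℓ} → ExcludedMiddle ℓ → {X : Set ℓ} {P Q : X → Set ℓ} →
         ¬ (∀ x → P x → Q x) → ∃ λ x → P x × ¬ Q x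
¬∀⇒∃×¬ em {X} {P} {Q} ¬∀PQ with em {∃ λ x → P x × ¬ Q x}
... | yes counterexample = counterexample
... | no  ¬counterexample =
  ⊥-elim (¬∀PQ λ x Px → em⇒dne em λ ¬Qx → ¬counterexample (x , Px , ¬Qx))

module _ (R : CompleteOrderedField) where
  open CompleteOrderedField R
  open Fuzzy R
  open IsTotalOrder isTotalOrder using (antisym) renaming (refl to ≤-refl; trans to ≤-trans)

  N⊥0≡1 : N⊥ 0ℝ ≡ 1ℝ
  N⊥0≡1 with 0ℝ ≟ 0ℝ
  ... | yes _   = refl
  ... | no  0≢0 = ⊥-elim (0≢0 refl)

  N⊥-nonzero : ∀ {x} → ¬ (x ≡ 0ℝ) → N⊥ x ≡ 0ℝ
  N⊥-nonzero {x} x≢0 with x ≟ 0ℝ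
  ... | yes x≡0 = ⊥-elim (x≢0 x≡0)
  ... | no  _   = refl

  NI≢N⊥⇒x≢0×NI≢0 : ∀ {I x} → I 0ℝ 0ℝ ≡ 1ℝ → ¬ (NI I x ≡ N⊥ x) →
                   ¬ (x ≡ 0ℝ) × ¬ (NI I x ≡ 0ℝ)
  NI≢N⊥⇒x≢0×NI≢0 {I} {x} I00≡1 NIx≢N⊥x = x≢0 , NIx≢0
    where
    x≢0 : ¬ (x ≡ 0ℝ)
    x≢0 refl = NIx≢N⊥x (trans I00≡1 (sym N⊥0≡1))
    NIx≢0 : ¬ (NI I x ≡ 0ℝ)
    NIx≢0 NIx≡0 = NIx≢N⊥x (trans NIx≡0 (sym (N⊥-nonzero x≢0)))

  0∈I : ∀ {x} → InI x → InI 0ℝ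
  0∈I (0≤x , x≤1) = ≤-refl , ≤-trans 0≤x x≤1

  1∈I : ∀ {x} → InI x → InI 1ℝ
  1∈I (0≤x , x≤1) = ≤-trans 0≤x x≤1 , ≤-refl

  A5⇒A[x,I[x,y]]≤y : ∀ {I A} → SatisfiesA5 I A → ∀ {x y} → InI x → InI y → A x (I x y) ≤ y
  A5⇒A[x,I[x,y]]≤y {I} {A} a5 {x} {y} x∈I y∈I =
    proj₁ (a5 Bool Bool D B D∈I (true , refl) B∈I (true , refl) false) (A x (I x y)) (false , refl)
    where
    D B : Bool → ℝ
    D true  = 1ℝ
    D false = x
    B true  = 1ℝ
    B false = y
    D∈I : IsFuzzySet D
    D∈I true  = 1∈I x∈I
    D∈I false = x∈I
    B∈I : IsFuzzySet B
    B∈I true  = 1∈I x∈I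
    B∈I false = y∈I

  A5⇒A[x,NI[x]]≡0 : ∀ {I A} → IsFuzzyImplication I → IsAggregation A → SatisfiesA5 I A →
                    ∀ {x} → InI x → A x (NI I x) ≡ 0ℝ
  A5⇒A[x,NI[x]]≡0 {I} {A} (I-range , _) (A-range , _) a5 x∈I = antisym
    (A5⇒A[x,I[x,y]]≤y {I} {A} a5 x∈I (0∈I x∈I))
    (proj₁ (A-range _ _ x∈I (I-range _ _ x∈I (0∈I x∈I))))

proposition3p11 : (R : CompleteOrderedField) → ExcludedMiddle 0ℓ →
    let open CompleteOrderedField R
        open Fuzzy R
    in (I A : ℝ → ℝ → ℝ) → IsFuzzyImplication I → IsAggregation A →
       SatisfiesA5 I A →
       (∀ x → InI x → N⊥ x ≤ NI I x) →
       ¬ (∀ x → InI x → NI I x ≡ N⊥ x) →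
       Σ ℝ (λ x → Σ ℝ (λ y →
         (0ℝ < x) × (x ≤ 1ℝ) × (0ℝ < y) × (y ≤ 1ℝ) × (A x y ≡ 0ℝ)))
proposition3p11 R em I A I-fuzzy@(I-range , _ , _ , I00≡1 , _) A-agg a5 _ NI≉N⊥
  with ¬∀⇒∃×¬ em NI≉N⊥
... | x , x∈I@(0≤x , x≤1) , NIx≢N⊥x
  with NI≢N⊥⇒x≢0×NI≢0 R {I} I00≡1 NIx≢N⊥x | I-range x _ x∈I (0∈I R x∈I)
... | x≢0 , NIx≢0 | 0≤NIx , NIx≤1 =
  x , I x _ , (0≤x , x≢0 ∘ sym) , x≤1 , (0≤NIx , NIx≢0 ∘ sym) , NIx≤1 ,
  A5⇒A[x,NI[x]]≡0 R {I} {A} I-fuzzy A-agg a5 x∈I
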